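{- Let $C\ge 2$ and $k$ be positive integers. For any $C$-uniform hypergraph $H$ with at least one edge and maximum degree at most $k$, there exists a $k$-regular $C$-uniform hypergraph $H'$ containing $H$ (as a subhypergraph, i.e. $V(H)\subseteq V(H')$ and the edge multiset of $H$ is contained in that of $H'$) such that $H'$ has the same maximum codegree as $H$.
   Context: A hypergraph is a pair $H=(V,E)$ with $V$ a finite vertex set and $E$ a multiset of subsets of $V$ (edges). $H$ is $C$-uniform if every edge has $C$ vertices. The degree of a vertex is the number of edges containing it; $H$ is $k$-regular if all degrees equal $k$. The codegree of two distinct vertices is the number of edges containing both; the maximum codegree is the maximum over pairs of distinct vertices. -}

module Defs where

open import Data.Nat using (ℕ; zero; suc; _+_; _⊔_)
open import Data.Bool using (Bool; true; false; _∧_; if_then_else_)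
open import Data.Fin using (Fin; _≟_)
open import Data.Fin.Subset using (Subset; outside; ∣_∣)
open import Data.Vec using (lookup; _++_; replicate)
open import Data.List using (List; []; _∷_; map; foldr; concatMap; allFin)
open import Relation.Nullary using (does)

-- A hypergraph on the vertex set Fin n; its edges form a multiset,
-- represented as a list of subsets of Fin n (order irrelevant, repetitions allowed).
record Hypergraph : Set where
  constructor hg
  field
    n     : ℕ
    edges : List (Subset n)
open Hypergraph public

count : {A : Set} → (A → Bool) → List A → ℕ
count p [] = 0
count p (x ∷ xs) = (if p x then 1 else 0) + count p xs

Uniform : ℕ → Hypergraph → Set
Uniform C H = ∀ {e} → e ∈ₗ edges H → ∣ e ∣ ≡ C
  where
    open import Data.List.Membership.Propositional renaming (_∈_ to _∈ₗ_)
    open import Relation.Binary.PropositionalEquality using (_≡_)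

degree : (H : Hypergraph) → Fin (n H) → ℕ
degree H v = count (λ e → lookup e v) (edges H)

codegree : (H : Hypergraph) → Fin (n H) → Fin (n H) → ℕ
codegree H u v = count (λ e → lookup e u ∧ lookup e v) (edges H)

-- maximum codegree over pairs of distinct vertices (0 if there is no such pair)
maxCodegree : Hypergraph → ℕ
maxCodegree H =
  foldr _⊔_ 0
    (concatMap (λ u → map (λ v → if does (u ≟ v) then 0 else codegree H u v)
                          (allFin (n H)))
               (allFin (n H)))

liftSubset : {n : ℕ} (m : ℕ) → Subset n → Subset (n + m)
liftSubset m e = e ++ replicate m outside

-- Take C disjoint copies of H and, for every vertex u whose degree is still below k,
-- add the transversal edge {(i, u) | i < C} of size C. Every degree below k grows by one,
-- two vertices of the same copy keep their codegree, and two vertices of different copies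
-- share at most one transversal, so the maximum codegree (at least 1, as H has an edge of
-- size at least 2) is unchanged. Iterating until every degree equals k gives a k-regular
-- hypergraph; the first copy made in the first round is H itself.
module Submission where

open import Defs
open import Data.Bool using (Bool; true; false; _∧_; if_then_else_)
open import Data.Bool.Properties using (∧-zeroʳ; ¬-not)
open import Data.Fin using (Fin; zero; suc; combine; remQuot; _≟_)
import Data.Fin.Properties as Fin
open import Data.Fin.Subset using (Subset; ⊥; ⁅_⁆; ∣_∣)
open import Data.Fin.Subset.Properties using (∣⊥∣≡0; ∣⁅x⁆∣≡1; x∈⁅x⁆; x≢y⇒x∉⁅y⁆)
open import Data.List using (List; []; _∷_; map; _++_; concat; tabulate; replicate; length)
import Data.List.Properties as List
open import Data.List.Membership.Propositional using (_∈_)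
import Data.List.Relation.Unary.All as All
import Data.List.Relation.Unary.All.Properties as All
open import Data.List.Relation.Unary.Any using (here; there)
import Data.List.Relation.Unary.Any.Properties as Any
open import Data.List.Relation.Binary.Permutation.Propositional using (_↭_; ↭-reflexive; ↭-trans)
import Data.List.Relation.Binary.Permutation.Propositional.Properties as ↭
open import Data.Nat using (ℕ; zero; suc; _+_; _*_; _∸_; _⊓_; _≤_; pred; z≤n; s≤s)
open import Data.Nat.Properties
  using ( +-assoc; +-identityʳ; +-monoʳ-≤; ≤-refl; ≤-reflexive; ≤-trans; ≤-antisym; module ≤-Reasoning
        ; m≤n⇒m≤1+n; m≤n+m; n≤0⇒n≡0; pred-mono-≤; ⊔-lub; m≤n⇒m≤n⊔o; m≤n⇒m≤o⊔n; m⊓n≤m; m⊓n≤n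
        ; m∸n≤m; m∸n≡0⇒m≤n; m+[n∸m]≡n; ∸-+-assoc )
open import Data.Product using (Σ; ∃; ∃₂; _×_; _,_; proj₁; proj₂)
open import Data.Sum using ([_,_]; inj₂)
import Data.Vec as Vec
open import Data.Vec using (lookup; cast)
import Data.Vec.Properties as Vec
open import Function using (_∘_)
open import Relation.Binary.PropositionalEquality using (_≡_; _≢_; refl; sym; trans; cong; cong₂; subst; module ≡-Reasoning)
open import Relation.Nullary using (yes; no; does; contradiction)

module _ {A : Set} (p : A → Bool) where

  count-++ : ∀ xs ys → count p (xs ++ ys) ≡ count p xs + count p ys
  count-++ []       ys = refl
  count-++ (x ∷ xs) ys = trans (cong (_ +_) (count-++ xs ys)) (sym (+-assoc (if p x then 1 else 0) _ _))

  count-none : (∀ x → p x ≡ false) → ∀ xs → count p xs ≡ 0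
  count-none none []       = refl
  count-none none (x ∷ xs) rewrite none x = count-none none xs

  count≤length : ∀ xs → count p xs ≤ length xs
  count≤length []       = z≤n
  count≤length (x ∷ xs) with p x
  ... | true  = s≤s (count≤length xs)
  ... | false = m≤n⇒m≤1+n (count≤length xs)

  count-replicate-true : ∀ {x} → p x ≡ true → ∀ r → count p (replicate r x) ≡ r
  count-replicate-true px zero    = refl
  count-replicate-true px (suc r) rewrite px = cong suc (count-replicate-true px r)

  count-replicate-false : ∀ {x} → p x ≡ false → ∀ r → count p (replicate r x) ≡ 0
  count-replicate-false px zero    = refl
  count-replicate-false px (suc r) rewrite px = count-replicate-false px r

  1≤count : ∀ {x xs} → x ∈ xs → p x ≡ true → 1 ≤ count p xs
  1≤count (here refl) px rewrite px = s≤s z≤n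
  1≤count (there x∈xs) px = ≤-trans (1≤count x∈xs px) (m≤n+m _ _)

  count-concat-tabulate-none : ∀ {c} (g : Fin c → List A) →
    (∀ j → count p (g j) ≡ 0) → count p (concat (tabulate g)) ≡ 0
  count-concat-tabulate-none {zero}  g none = refl
  count-concat-tabulate-none {suc c} g none =
    trans (count-++ (g zero) _) (cong₂ _+_ (none zero) (count-concat-tabulate-none (g ∘ suc) (none ∘ suc)))

  count-concat-tabulate-single : ∀ {c} (g : Fin c → List A) i →
    (∀ j → j ≢ i → count p (g j) ≡ 0) → count p (concat (tabulate g)) ≡ count p (g i)
  count-concat-tabulate-single {suc c} g zero others =
    trans (count-++ (g zero) _)
      (trans (cong (count p (g zero) +_) (count-concat-tabulate-none (g ∘ suc) (λ j → others (suc j) λ ()))) (+-identityʳ _))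
  count-concat-tabulate-single {suc c} g (suc i) others =
    trans (count-++ (g zero) _)
      (trans (cong (_+ count p (concat (tabulate (g ∘ suc)))) (others zero λ ()))
        (count-concat-tabulate-single (g ∘ suc) i (λ j j≢i → others (suc j) (j≢i ∘ Fin.suc-injective))))

count-cong : ∀ {A : Set} {p q : A → Bool} → (∀ x → p x ≡ q x) → ∀ xs → count p xs ≡ count q xs
count-cong p≗q []       = refl
count-cong p≗q (x ∷ xs) = cong₂ _+_ (cong (if_then 1 else 0) (p≗q x)) (count-cong p≗q xs)

count-map : ∀ {A B : Set} (p : B → Bool) (f : A → B) xs → count p (map f xs) ≡ count (p ∘ f) xs
count-map p f []       = refl
count-map p f (x ∷ xs) = cong (_ +_) (count-map p f xs)

∣p++q∣≡∣p∣+∣q∣ : ∀ {m n} (p : Subset m) (q : Subset n) → ∣ p Vec.++ q ∣ ≡ ∣ p ∣ + ∣ q ∣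
∣p++q∣≡∣p∣+∣q∣ Vec.[]            q = refl
∣p++q∣≡∣p∣+∣q∣ (true  Vec.∷ p) q = cong suc (∣p++q∣≡∣p∣+∣q∣ p q)
∣p++q∣≡∣p∣+∣q∣ (false Vec.∷ p) q = ∣p++q∣≡∣p∣+∣q∣ p q

1≤∣p∣⇒member : ∀ {n} (p : Subset n) → 1 ≤ ∣ p ∣ → ∃ λ a → lookup p a ≡ true
1≤∣p∣⇒member (true  Vec.∷ p) _   = zero , refl
1≤∣p∣⇒member (false Vec.∷ p) 1≤∣p∣ with 1≤∣p∣⇒member p 1≤∣p∣
... | a , pa = suc a , pa

2≤∣p∣⇒two-members : ∀ {n} (p : Subset n) → 2 ≤ ∣ p ∣ →
  ∃₂ λ a b → a ≢ b × lookup p a ≡ true × lookup p b ≡ true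
2≤∣p∣⇒two-members (true  Vec.∷ p) (s≤s 1≤∣p∣) with 1≤∣p∣⇒member p 1≤∣p∣
... | b , pb = zero , suc b , (λ ()) , refl , pb
2≤∣p∣⇒two-members (false Vec.∷ p) 2≤∣p∣ with 2≤∣p∣⇒two-members p 2≤∣p∣
... | a , b , a≢b , pa , pb = suc a , suc b , a≢b ∘ Fin.suc-injective , pa , pb

lookup-⁅x⁆ : ∀ {n} (x : Fin n) → lookup ⁅ x ⁆ x ≡ true
lookup-⁅x⁆ x = Vec.[]=⇒lookup (x∈⁅x⁆ x)

lookup-⁅y⁆-≢ : ∀ {n} {x y : Fin n} → x ≢ y → lookup ⁅ y ⁆ x ≡ false
lookup-⁅y⁆-≢ {x = x} {y} x≢y = ¬-not (x≢y⇒x∉⁅y⁆ x≢y ∘ Vec.lookup⇒[]= x ⁅ y ⁆)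

lookup-⁅z⁆-∧ : ∀ {n} (z : Fin n) {x y} → x ≢ y → lookup ⁅ z ⁆ x ∧ lookup ⁅ z ⁆ y ≡ false
lookup-⁅z⁆-∧ z {x} {y} x≢y with x ≟ z
... | yes refl = trans (cong (_ ∧_) (lookup-⁅y⁆-≢ (x≢y ∘ sym))) (∧-zeroʳ _)
... | no  x≢z  = cong (_∧ _) (lookup-⁅y⁆-≢ x≢z)

replicate-++ : ∀ {A : Set} a b (x : A) → Vec.replicate a x Vec.++ Vec.replicate b x ≡ Vec.replicate (a + b) x
replicate-++ zero    b x = refl
replicate-++ (suc a) b x = cong (x Vec.∷_) (replicate-++ a b x)

liftSubset-+ : ∀ {n a b} .(eq : n + a + b ≡ n + (a + b)) (p : Subset n) →
  cast eq (liftSubset b (liftSubset a p)) ≡ liftSubset (a + b) p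
liftSubset-+ {a = a} {b} eq p =
  trans (Vec.++-assoc-eqFree p (Vec.replicate a false) (Vec.replicate b false))
        (cong (p Vec.++_) (replicate-++ a b false))

-- The vertex set of C copies of Fin n is Fin (C * n), with vertex u of copy i at combine i u.

copy : ∀ {c n} → Fin c → Subset n → Subset (c * n)
copy {suc c} zero    p = p Vec.++ ⊥
copy {suc c} (suc i) p = ⊥ Vec.++ copy i p

lookup-copy : ∀ {c n} (i : Fin c) (p : Subset n) u → lookup (copy i p) (combine i u) ≡ lookup p u
lookup-copy {suc c} {n} zero    p u = Vec.lookup-++ˡ p (⊥ {c * n}) u
lookup-copy {suc c} {n} (suc i) p u = trans (Vec.lookup-++ʳ (⊥ {n}) (copy i p) (combine i u)) (lookup-copy i p u)

lookup-copy-≢ : ∀ {c n} {i j : Fin c} (p : Subset n) u → j ≢ i → lookup (copy i p) (combine j u) ≡ false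
lookup-copy-≢ {suc c} {n} {zero}  {zero}  p u j≢i = contradiction refl j≢i
lookup-copy-≢ {suc c} {n} {zero}  {suc j} p u _   =
  trans (Vec.lookup-++ʳ p (⊥ {c * n}) (combine j u)) (Vec.lookup-replicate (combine j u) false)
lookup-copy-≢ {suc c} {n} {suc i} {zero}  p u _   =
  trans (Vec.lookup-++ˡ (⊥ {n}) (copy i p) u) (Vec.lookup-replicate u false)
lookup-copy-≢ {suc c} {n} {suc i} {suc j} p u j≢i =
  trans (Vec.lookup-++ʳ (⊥ {n}) (copy i p) (combine j u)) (lookup-copy-≢ p u (j≢i ∘ cong suc))

∣copy∣ : ∀ {c n} (i : Fin c) (p : Subset n) → ∣ copy i p ∣ ≡ ∣ p ∣
∣copy∣ {suc c} {n} zero    p =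
  trans (∣p++q∣≡∣p∣+∣q∣ p (⊥ {c * n})) (trans (cong (∣ p ∣ +_) (∣⊥∣≡0 (c * n))) (+-identityʳ _))
∣copy∣ {suc c} {n} (suc i) p =
  trans (∣p++q∣≡∣p∣+∣q∣ (⊥ {n}) (copy i p)) (trans (cong (_+ ∣ copy i p ∣) (∣⊥∣≡0 n)) (∣copy∣ i p))

fibre : ∀ c {n} → Fin n → Subset (c * n)
fibre c u = Vec.concat (Vec.replicate c ⁅ u ⁆)

lookup-fibre : ∀ {c n} (u : Fin n) (i : Fin c) v → lookup (fibre c u) (combine i v) ≡ lookup ⁅ u ⁆ v
lookup-fibre {c} u i v =
  trans (Vec.lookup-concat (Vec.replicate c ⁅ u ⁆) i v) (cong (λ p → lookup p v) (Vec.lookup-replicate i ⁅ u ⁆))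

∣fibre∣ : ∀ c {n} (u : Fin n) → ∣ fibre c u ∣ ≡ c
∣fibre∣ zero    u = refl
∣fibre∣ (suc c) u = trans (∣p++q∣≡∣p∣+∣q∣ ⁅ u ⁆ (fibre c u)) (cong₂ _+_ (∣⁅x⁆∣≡1 u) (∣fibre∣ c u))

∀-combine : ∀ {c n} {P : Fin (c * n) → Set} → (∀ i u → P (combine i u)) → ∀ w → P w
∀-combine {c} {n} {P} P-combine w =
  subst P (Fin.combine-remQuot {c} n w) (P-combine (proj₁ (remQuot {c} n w)) (proj₂ (remQuot {c} n w)))

maxCodegree-lub : ∀ H {d} → (∀ u v → u ≢ v → codegree H u v ≤ d) → maxCodegree H ≤ d
maxCodegree-lub H {d} codegree≤d =
  List.foldr-preservesᵇ {P = _≤ d} ⊔-lub z≤n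
    (All.concat⁺ (All.map⁺ (All.tabulate⁺ λ u → All.map⁺ (All.tabulate⁺ (entry≤d u)))))
  where
  entry≤d : ∀ u v → (if does (u ≟ v) then 0 else codegree H u v) ≤ d
  entry≤d u v with u ≟ v
  ... | yes _   = z≤n
  ... | no  u≢v = codegree≤d u v u≢v

codegree≤maxCodegree : ∀ H {u v} → u ≢ v → codegree H u v ≤ maxCodegree H
codegree≤maxCodegree H {u} {v} u≢v =
  List.foldr-preservesᵒ {P = codegree H u v ≤_} (λ x y → [ m≤n⇒m≤n⊔o y , m≤n⇒m≤o⊔n x ]) 0 _
    (inj₂ (Any.concat⁺ (Any.map⁺ (Any.tabulate⁺ u (Any.map⁺ (Any.tabulate⁺ v entry))))))
  where
  entry : codegree H u v ≤ (if does (u ≟ v) then 0 else codegree H u v)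
  entry with u ≟ v
  ... | yes u≡v = contradiction u≡v u≢v
  ... | no  _   = ≤-refl

1≤maxCodegree : ∀ H {e} → e ∈ edges H → 2 ≤ ∣ e ∣ → 1 ≤ maxCodegree H
1≤maxCodegree H {e} e∈H 2≤∣e∣ with 2≤∣p∣⇒two-members e 2≤∣e∣
... | a , b , a≢b , a∈e , b∈e =
  ≤-trans (1≤count (λ e′ → lookup e′ a ∧ lookup e′ b) e∈H (cong₂ _∧_ a∈e b∈e))
          (codegree≤maxCodegree H a≢b)

m+1⊓[n∸m]≤n : ∀ {m n} → m ≤ n → m + 1 ⊓ (n ∸ m) ≤ n
m+1⊓[n∸m]≤n {m} {n} m≤n = ≤-trans (+-monoʳ-≤ m (m⊓n≤n 1 (n ∸ m))) (≤-reflexive (m+[n∸m]≡n m≤n))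

n∸[m+1⊓[n∸m]]≡pred[n∸m] : ∀ m n → n ∸ (m + 1 ⊓ (n ∸ m)) ≡ pred (n ∸ m)
n∸[m+1⊓[n∸m]]≡pred[n∸m] m n = trans (sym (∸-+-assoc n m _)) (x∸[1⊓x]≡pred[x] (n ∸ m))
  where
  x∸[1⊓x]≡pred[x] : ∀ x → x ∸ 1 ⊓ x ≡ pred x
  x∸[1⊓x]≡pred[x] zero    = refl
  x∸[1⊓x]≡pred[x] (suc x) = refl

module Blowup (C′ k : ℕ) {n : ℕ} (es : List (Subset n)) where

  C : ℕ
  C = suc C′

  H : Hypergraph
  H = hg n es

  shortfall : Fin n → ℕ
  shortfall u = 1 ⊓ (k ∸ degree H u)

  copies : List (Subset (C * n))
  copies = concat (tabulate λ (i : Fin C) → map (copy i) es)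

  transversals : Fin n → List (Subset (C * n))
  transversals u = replicate (shortfall u) (fibre C u)

  blowup : List (Subset (C * n))
  blowup = copies ++ concat (tabulate transversals)

  H⁺ : Hypergraph
  H⁺ = hg (C * n) blowup

  blowup-rest : List (Subset (C * n))
  blowup-rest = concat (tabulate λ (i : Fin C′) → map (copy (suc i)) es) ++ concat (tabulate transversals)

  blowup-extends : blowup ≡ map (liftSubset (C′ * n)) es ++ blowup-rest
  blowup-extends = List.++-assoc (map (copy {C} zero) es) _ _

  uniform-blowup : Uniform C H → Uniform C H⁺
  uniform-blowup U = All.lookup (All.++⁺
    (All.concat⁺ (All.tabulate⁺ λ (i : Fin C) →
      All.map⁺ {f = copy i} (All.tabulate λ {e} e∈es → trans (∣copy∣ i e) (U e∈es))))
    (All.concat⁺ (All.tabulate⁺ λ u → All.replicate⁺ (shortfall u) (∣fibre∣ C u))))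

  module _ {p : Subset (C * n) → Bool} where

    count-copies : ∀ (i : Fin C) → (∀ (j : Fin C) e → j ≢ i → p (copy j e) ≡ false) →
      count p copies ≡ count (p ∘ copy i) es
    count-copies i outside-i = trans
      (count-concat-tabulate-single p (λ j → map (copy j) es) i λ j j≢i →
        trans (count-map p (copy j) es) (count-none _ (λ e → outside-i j e j≢i) es))
      (count-map p (copy i) es)

    count-transversals : ∀ u → (∀ w → w ≢ u → p (fibre C w) ≡ false) →
      count p (concat (tabulate transversals)) ≡ count p (transversals u)
    count-transversals u outside-u = count-concat-tabulate-single p transversals u
      λ w w≢u → count-replicate-false p (outside-u w w≢u) (shortfall w)

  degree-blowup : ∀ (i : Fin C) u → degree H⁺ (combine i u) ≡ degree H u + shortfall u
  degree-blowup i u = begin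
    count P blowup                                                       ≡⟨ count-++ P copies _ ⟩
    count P copies + count P (concat (tabulate transversals))            ≡⟨ cong₂ _+_ in-copies in-transversals ⟩
    degree H u + shortfall u                                             ∎
    where
    open ≡-Reasoning
    P : Subset (C * n) → Bool
    P e = lookup e (combine i u)
    in-copies : count P copies ≡ degree H u
    in-copies = trans (count-copies i λ j e j≢i → lookup-copy-≢ e u (j≢i ∘ sym))
                      (count-cong (λ e → lookup-copy i e u) es)
    in-transversals : count P (concat (tabulate transversals)) ≡ shortfall u
    in-transversals =
      trans (count-transversals u λ w w≢u → trans (lookup-fibre w i u) (lookup-⁅y⁆-≢ (w≢u ∘ sym)))
            (count-replicate-true P (trans (lookup-fibre u i u) (lookup-⁅x⁆ u)) (shortfall u))

  codegree-blowup : ∀ (i : Fin C) {u v} → u ≢ v → codegree H⁺ (combine i u) (combine i v) ≡ codegree H u v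
  codegree-blowup i {u} {v} u≢v = begin
    count P blowup                                                       ≡⟨ count-++ P copies _ ⟩
    count P copies + count P (concat (tabulate transversals))            ≡⟨ cong₂ _+_ in-copies in-transversals ⟩
    codegree H u v + 0                                                   ≡⟨ +-identityʳ _ ⟩
    codegree H u v                                                       ∎
    where
    open ≡-Reasoning
    P : Subset (C * n) → Bool
    P e = lookup e (combine i u) ∧ lookup e (combine i v)
    in-copies : count P copies ≡ codegree H u v
    in-copies = trans (count-copies i λ j e j≢i → cong (_∧ _) (lookup-copy-≢ e u (j≢i ∘ sym)))
                      (count-cong (λ e → cong₂ _∧_ (lookup-copy i e u) (lookup-copy i e v)) es)
    in-transversals : count P (concat (tabulate transversals)) ≡ 0
    in-transversals = count-concat-tabulate-none P transversals λ w →
      count-replicate-false P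
        (trans (cong₂ _∧_ (lookup-fibre w i u) (lookup-fibre w i v)) (lookup-⁅z⁆-∧ w u≢v)) (shortfall w)

  codegree-blowup-≢ : ∀ {i j : Fin C} u v → i ≢ j → codegree H⁺ (combine i u) (combine j v) ≤ 1
  codegree-blowup-≢ {i} {j} u v i≢j = begin
    count P blowup                                                       ≡⟨ count-++ P copies _ ⟩
    count P copies + count P (concat (tabulate transversals))            ≡⟨ cong₂ _+_ in-copies in-transversals ⟩
    count P (transversals u)                                             ≤⟨ count≤length P (transversals u) ⟩
    length (transversals u)                                              ≡⟨ List.length-replicate (shortfall u) ⟩
    shortfall u                                                          ≤⟨ m⊓n≤m 1 _ ⟩
    1                                                                    ∎
    where
    open ≤-Reasoning
    P : Subset (C * n) → Bool
    P e = lookup e (combine i u) ∧ lookup e (combine j v)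
    copy-∧ : ∀ l e → P (copy l e) ≡ false
    copy-∧ l e with i ≟ l
    ... | yes refl = trans (cong (_ ∧_) (lookup-copy-≢ e v (i≢j ∘ sym))) (∧-zeroʳ _)
    ... | no  i≢l  = cong (_∧ _) (lookup-copy-≢ e u i≢l)
    in-copies : count P copies ≡ 0
    in-copies = count-concat-tabulate-none P (λ l → map (copy l) es) λ l →
      trans (count-map P (copy l) es) (count-none _ (copy-∧ l) es)
    in-transversals : count P (concat (tabulate transversals)) ≡ count P (transversals u)
    in-transversals = count-transversals u λ w w≢u →
      cong (_∧ _) (trans (lookup-fibre w i u) (lookup-⁅y⁆-≢ (w≢u ∘ sym)))

  maxCodegree-blowup : 1 ≤ maxCodegree H → maxCodegree H⁺ ≡ maxCodegree H
  maxCodegree-blowup 1≤mc = ≤-antisym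
    (maxCodegree-lub H⁺ (∀-combine λ i u → ∀-combine λ j v → codegree⁺≤maxCodegree i u j v))
    (maxCodegree-lub H λ u v u≢v →
      subst (_≤ maxCodegree H⁺) (codegree-blowup zero u≢v)
        (codegree≤maxCodegree H⁺ (u≢v ∘ Fin.combine-injectiveʳ {C} zero u zero v)))
    where
    codegree⁺≤maxCodegree : ∀ i u j v → combine i u ≢ combine j v → codegree H⁺ (combine i u) (combine j v) ≤ maxCodegree H
    codegree⁺≤maxCodegree i u j v iu≢jv with i ≟ j
    ... | yes refl = ≤-trans (≤-reflexive (codegree-blowup i u≢v)) (codegree≤maxCodegree H u≢v)
      where
      u≢v : u ≢ v
      u≢v = iu≢jv ∘ cong (combine i)
    ... | no  i≢j  = ≤-trans (codegree-blowup-≢ u v i≢j) 1≤mc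

  degree-blowup-≤ : (∀ v → degree H v ≤ k) → ∀ w → degree H⁺ w ≤ k
  degree-blowup-≤ degree≤k = ∀-combine λ i u →
    subst (_≤ k) (sym (degree-blowup i u)) (m+1⊓[n∸m]≤n (degree≤k u))

  gap-blowup : ∀ {t} → (∀ v → k ∸ degree H v ≤ t) → ∀ w → k ∸ degree H⁺ w ≤ pred t
  gap-blowup {t} gap≤t = ∀-combine λ i u → begin
    k ∸ degree H⁺ (combine i u)               ≡⟨ cong (k ∸_) (degree-blowup i u) ⟩
    k ∸ (degree H u + shortfall u)            ≡⟨ n∸[m+1⊓[n∸m]]≡pred[n∸m] (degree H u) k ⟩
    pred (k ∸ degree H u)                     ≤⟨ pred-mono-≤ (gap≤t u) ⟩
    pred t                                    ∎
    where open ≤-Reasoning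

Regular : ℕ → Hypergraph → Set
Regular k H = ∀ v → degree H v ≡ k

Completion : (C k : ℕ) {n : ℕ} → List (Subset n) → Set
Completion C k {n} es = Σ ℕ λ m → Σ (List (Subset (n + m))) λ es′ →
  let H′ = hg (n + m) es′ in
  Uniform C H′ × Regular k H′ × (∃ λ rest → es′ ↭ map (liftSubset m) es ++ rest)
  × maxCodegree H′ ≡ maxCodegree (hg n es)

hg-cast : (P : Hypergraph → Set) {m m′ : ℕ} (eq : m ≡ m′) (es : List (Subset m)) →
  P (hg m es) → P (hg m′ (map (cast eq) es))
hg-cast P {m} refl es =
  subst (P ∘ hg m) (sym (trans (List.map-cong (Vec.cast-is-id refl) es) (List.map-id es)))

Completion-trans : ∀ {C k n a} {es : List (Subset n)} {es₁ : List (Subset (n + a))} {rest} →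
  es₁ ≡ map (liftSubset a) es ++ rest → maxCodegree (hg (n + a) es₁) ≡ maxCodegree (hg n es) →
  Completion C k es₁ → Completion C k es
Completion-trans {C} {k} {n} {a} {es} {es₁} {rest} es₁≡ mc₁≡ (m , es₂ , U , R , (rest₂ , es₂↭) , mc₂≡) =
  a + m , map T es₂ , proj₁ transported , proj₁ (proj₂ transported)
  , (map (T ∘ liftSubset m) rest ++ map T rest₂ , es₂′↭) , trans (proj₂ (proj₂ transported)) mc₁≡
  where
  eq : n + a + m ≡ n + (a + m)
  eq = +-assoc n a m
  T : Subset (n + a + m) → Subset (n + (a + m))
  T = cast eq
  H₂′ : Hypergraph
  H₂′ = hg (n + (a + m)) (map T es₂)
  transported : Uniform C H₂′ × Regular k H₂′ × maxCodegree H₂′ ≡ maxCodegree (hg (n + a) es₁)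
  transported = hg-cast (λ H′ → Uniform C H′ × Regular k H′ × maxCodegree H′ ≡ maxCodegree (hg (n + a) es₁))
                        eq es₂ (U , R , mc₂≡)
  es₂′↭ : map T es₂ ↭ map (liftSubset (a + m)) es ++ (map (T ∘ liftSubset m) rest ++ map T rest₂)
  es₂′↭ = ↭-trans (↭.map⁺ T es₂↭) (↭-reflexive (begin
    map T (map (liftSubset m) es₁ ++ rest₂)            ≡⟨ List.map-++ T _ rest₂ ⟩
    map T (map (liftSubset m) es₁) ++ map T rest₂      ≡⟨ cong (_++ map T rest₂) (sym (List.map-∘ es₁)) ⟩
    map TL es₁ ++ map T rest₂                          ≡⟨ cong (λ xs → map TL xs ++ map T rest₂) es₁≡ ⟩
    map TL (map (liftSubset a) es ++ rest) ++ map T rest₂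
      ≡⟨ cong (_++ map T rest₂) (List.map-++ TL _ rest) ⟩
    (map TL (map (liftSubset a) es) ++ map TL rest) ++ map T rest₂
      ≡⟨ List.++-assoc (map TL (map (liftSubset a) es)) _ _ ⟩
    map TL (map (liftSubset a) es) ++ (map TL rest ++ map T rest₂)
      ≡⟨ cong (_++ (map TL rest ++ map T rest₂)) (trans (sym (List.map-∘ es)) (List.map-cong (liftSubset-+ eq) es)) ⟩
    map (liftSubset (a + m)) es ++ (map TL rest ++ map T rest₂) ∎))
    where
    open ≡-Reasoning
    TL : Subset (n + a) → Subset (n + (a + m))
    TL = T ∘ liftSubset m

completion : ∀ C′ k t {n} (es : List (Subset n)) → Uniform (suc C′) (hg n es) →
  (∀ v → degree (hg n es) v ≤ k) → (∀ v → k ∸ degree (hg n es) v ≤ t) → 1 ≤ maxCodegree (hg n es) →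
  Completion (suc C′) k es
-- n + 0 is not definitionally n, so even a k-regular H goes through one more
-- (transversal-free) blowup to be returned over a vertex set of the form n + m.
completion C′ k zero {n} es U degree≤k gap≤0 1≤mc =
  C′ * n , blowup , uniform-blowup U , regular , (_ , ↭-reflexive blowup-extends) , maxCodegree-blowup 1≤mc
  where
  open Blowup C′ k es
  regular : Regular k H⁺
  regular w = ≤-antisym (degree-blowup-≤ degree≤k w) (m∸n≡0⇒m≤n (n≤0⇒n≡0 (gap-blowup gap≤0 w)))
completion C′ k (suc t) es U degree≤k gap≤t 1≤mc =
  Completion-trans blowup-extends (maxCodegree-blowup 1≤mc)
    (completion C′ k t blowup (uniform-blowup U) (degree-blowup-≤ degree≤k) (gap-blowup gap≤t)
              (subst (1 ≤_) (sym (maxCodegree-blowup 1≤mc)) 1≤mc))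
  where open Blowup C′ k es

lemma3p2 : (C k : ℕ) → 2 ≤ C → 1 ≤ k → (H : Hypergraph) → Uniform C H
    → (∃ λ e → ∃ λ es → edges H ≡ e ∷ es)
    → (∀ v → degree H v ≤ k)
    → Σ ℕ λ m → Σ (List (Subset (n H + m))) λ es′ →
        let H′ = hg (n H + m) es′ in
        Uniform C H′
        × (∀ v → degree H′ v ≡ k)
        × (∃ λ rest → es′ ↭ (map (liftSubset m) (edges H) ++ rest))
        × maxCodegree H′ ≡ maxCodegree H
lemma3p2 (suc C′) k 2≤C _ H U (e , es , edges≡) degree≤k =
  completion C′ k k (edges H) U degree≤k (λ v → m∸n≤m k (degree H v))
    (1≤maxCodegree H e∈H (subst (2 ≤_) (sym (U e∈H)) 2≤C))
  where
  e∈H : e ∈ edges H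
  e∈H = subst (e ∈_) (sym edges≡) (here refl)
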